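{- Let $m = p_1^{e_1}\cdots p_r^{e_r}$, $R=\{1,\dots,r\}$, $I\subseteq R$, and let $C_I$ be the connected component of the sequential power graph of $\mathbb{Z}/m\mathbb{Z}$ containing $d_I$. Regarding each element as its representative in $\{0,1,\ldots,m-1\}$ and summing as integers, the sum of the tail elements of $C_I$ equals $$\frac{m^2}{2}\cdot\frac{\phi(\pi_{R\setminus I})}{\pi_R} - \frac{m}{2}\cdot\phi(g_{R\setminus I}).$$
   Context: $m = p_1^{e_1}\cdots p_r^{e_r}$ with distinct primes, $e_i\ge1$; $\phi$ is Euler's totient function. For $J\subseteq R$: $\pi_J=\prod_{j\in J}p_j$, $g_J=\prod_{j\in J}p_j^{e_j}$ (both $=1$ for $J=\emptyset$), and $d_J$ is the idempotent with $d_J\equiv 0\pmod{p_i^{e_i}}$ for $i\in J$, $d_J\equiv1\pmod{p_j^{e_j}}$ for $j\notin J$. The sequential power graph of $\mathbb{Z}/m\mathbb{Z}$ is the directed graph on $\mathbb{Z}/m\mathbb{Z}$ with an edge $(b,c)$ iff $b\equiv a^i$, $c\equiv a^{i+1}\pmod m$ for some $a$ and $i\in\mathbb{N}$; connected components are with respect to undirected paths. An element $v$ is a tail if $v^{k+1}\not\equiv v\pmod m$ for all $k\ge1$. -}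

module Defs where

open import Data.Bool using (Bool; true; false; if_then_else_)
open import Data.Nat using (ℕ; zero; suc; _*_; _^_; _<_; _≤_)
open import Data.Nat.GCD using (gcd)
open import Data.Fin using (Fin; zero; suc)
open import Data.Fin.Subset using (Subset; ∁)
open import Data.Vec using (lookup)
open import Data.List using (List; length; filter; upTo)
open import Data.Integer as ℤ using (ℤ; +_)
open import Data.Integer.Divisibility using () renaming (_∣_ to _∣ℤ_)
open import Data.Product using (Σ; _×_)
open import Relation.Nullary using (¬_)
open import Relation.Binary.Construct.Closure.Equivalence using (EqClosure)
import Data.Nat as ℕ

∏ : ∀ {n} → (Fin n → ℕ) → ℕ
∏ {zero}  f = 1
∏ {suc n} f = f zero * ∏ (λ i → f (suc i))

-- Euler's totient: number of k ∈ {0,…,n-1} with gcd k n = 1 (standard for n ≥ 1)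
φ : ℕ → ℕ
φ n = length (filter (λ k → gcd k n ℕ.≟ 1) (upTo n))

infix 4 _≡_[mod_]
_≡_[mod_] : ℕ → ℕ → ℕ → Set
a ≡ b [mod n ] = (+ n) ∣ℤ ((+ a) ℤ.- (+ b))

πS : ∀ {r} → (Fin r → ℕ) → Subset r → ℕ
πS p J = ∏ (λ j → if lookup J j then p j else 1)

gS : ∀ {r} → (Fin r → ℕ) → (Fin r → ℕ) → Subset r → ℕ
gS p e J = ∏ (λ j → if lookup J j then p j ^ e j else 1)

modulus : ∀ {r} → (Fin r → ℕ) → (Fin r → ℕ) → ℕ
modulus p e = ∏ (λ i → p i ^ e i)

-- d is the idempotent d_J (as a residue): d ≡ 0 mod p_i^{e_i} (i ∈ J), d ≡ 1 mod p_j^{e_j} (j ∉ J)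
IsIdem : ∀ {r} → (Fin r → ℕ) → (Fin r → ℕ) → Subset r → ℕ → Set
IsIdem p e J d = ∀ j → if lookup J j then d ≡ 0 [mod p j ^ e j ] else d ≡ 1 [mod p j ^ e j ]

SPEdge : ℕ → ℕ → ℕ → Set
SPEdge m b c = Σ ℕ λ a → Σ ℕ λ i → (1 ≤ i) × (b ≡ a ^ i [mod m ]) × (c ≡ a ^ suc i [mod m ])

SPConnected : ℕ → ℕ → ℕ → Set
SPConnected m = EqClosure (SPEdge m)

Tail : ℕ → ℕ → Set
Tail m v = ∀ k → 1 ≤ k → ¬ (v ^ suc k ≡ v [mod m ])

module Submission where

-- Write q_j = p_j^{e_j}, π_J = ∏_{j∈J} p_j and g_J = ∏_{j∈J} q_j.  Along an edge (a^i, a^{i+1}) the set of primes p_j dividing the vertex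
--    does not change.  Every v has an idempotent power v^K, and by the Chinese remainder
--    theorem an idempotent is determined by the primes p_j dividing it.  Hence v lies in
--    C_I iff p_j ∣ v ⇔ j ∈ I, i.e. iff π_I ∣ v and gcd(v, π_{∁I}) = 1.
--  * Tails.  Such a v is a tail iff g_I ∤ v: if g_I ∣ v then v·v^K ≡ v, and conversely
--    v^{k+1} ≡ v forces q_j ∣ v for every j ∈ I.
--  * Counting, over 0 ≤ v < m.  C_I has (m/π_R)·φ(π_{∁I}) elements (multiples of π_I, then
--    periodicity mod π_{∁I}); its non-tails are the g_I·w with gcd(w, g_{∁I}) = 1, so there
--    are φ(g_{∁I}) of them.  The tails are closed under v ↦ m − v, so twice their sum is m
--    times their number, which rearranges to the stated formula.

open import Data.Nat
open import Data.Nat.Properties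
open import Data.Nat.DivMod
open import Data.Nat.Divisibility
open import Data.Nat.Primality
open import Data.Nat.Coprimality as Coprimality using (Coprime; coprime-divisor)
open import Data.Nat.GCD using (gcd)
open import Data.Nat.ListAction using (sum)
open import Data.Nat.ListAction.Properties using (sum-↭)
import Data.Integer as ℤ
import Data.Integer.Properties as ℤP
open import Data.Fin using (Fin; zero; suc; toℕ; fromℕ<)
import Data.Fin.Properties as Fin
open import Data.Fin.Subset using (Subset; ∁; ⊤)
open import Data.Vec using (lookup)
open import Data.Vec.Properties using (lookup-map; lookup-replicate)
open import Data.Bool using (Bool; true; false; if_then_else_; not)
open import Data.List using (List; filter; applyUpTo; upTo; length)
open import Data.List.Membership.Propositional using (_∈_)
open import Data.List.Membership.Propositional.Properties using (∈-filter⁺; ∈-filter⁻; ∈-upTo⁺; ∈-upTo⁻)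
open import Data.List.Membership.Propositional.Properties.WithK using (unique∧set⇒bag)
open import Data.List.Relation.Unary.Unique.Propositional using (Unique)
open import Data.List.Relation.Unary.Unique.Propositional.Properties using (filter⁺; upTo⁺)
open import Data.List.Relation.Binary.BagAndSetEquality using (∼bag⇒↭)
open import Data.Product
open import Data.Sum using (inj₁; inj₂)
open import Data.Empty using (⊥-elim)
open import Function using (_∘_; id; _⇔_; mk⇔; Equivalence)
import Function.Properties.Equivalence as ⇔
open import Function.Definitions using (Injective)
open import Relation.Binary.PropositionalEquality
open import Relation.Binary.Construct.Closure.ReflexiveTransitive using (ε; _◅_; _◅◅_)
open import Relation.Binary.Construct.Closure.Symmetric using (fwd; bwd)
open import Relation.Nullary using (¬_; Dec; yes; no; does; ¬?; _×-dec_)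
open import Relation.Nullary.Decidable using (does-⇔; dec-false)
open import Relation.Unary using (Pred; Decidable)
open import Algebra.Properties.CommutativeSemigroup +-commutativeSemigroup using () renaming (interchange to +-interchange)
open import Algebra.Properties.CommutativeSemigroup *-commutativeSemigroup using () renaming (interchange to *-interchange)
open import Data.Nat.Solver using (module +-*-Solver)
open import Defs

-- The congruence a ≡ b [mod n] of Defs (divisibility of an integer difference) agrees with
-- equality of remainders, which is what we compute with.
module Remainders (n : ℕ) .{{_ : NonZero n}} where

  ∣∸⇒%≡ : ∀ a b → b ≤ a → n ∣ a ∸ b → a % n ≡ b % n
  ∣∸⇒%≡ a b b≤a (divides k eq) = begin
      a % n              ≡⟨ cong (_% n) (sym (m+[n∸m]≡n b≤a)) ⟩
      (b + (a ∸ b)) % n  ≡⟨ cong (λ x → (b + x) % n) eq ⟩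
      (b + k * n) % n    ≡⟨ [m+kn]%n≡m%n b k n ⟩
      b % n              ∎
    where open ≡-Reasoning

  %≡⇒∣∸ : ∀ a b → b ≤ a → a % n ≡ b % n → n ∣ a ∸ b
  %≡⇒∣∸ a b b≤a eq = divides (a / n ∸ b / n) (begin
      a ∸ b                                     ≡⟨ cong₂ _∸_ (m≡m%n+[m/n]*n a n) (m≡m%n+[m/n]*n b n) ⟩
      (a % n + a / n * n) ∸ (b % n + b / n * n) ≡⟨ cong (λ x → (x + a / n * n) ∸ (b % n + b / n * n)) eq ⟩
      (b % n + a / n * n) ∸ (b % n + b / n * n) ≡⟨ [m+n]∸[m+o]≡n∸o (b % n) _ _ ⟩
      a / n * n ∸ b / n * n                     ≡⟨ *-distribʳ-∸ n (a / n) (b / n) ⟨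
      (a / n ∸ b / n) * n                       ∎)
    where open ≡-Reasoning

  private
    ∣diff∣ : ∀ a b → b ≤ a → ℤ.∣ ℤ.+ a ℤ.- ℤ.+ b ∣ ≡ a ∸ b
    ∣diff∣ a b b≤a = trans (cong ℤ.∣_∣ (ℤP.[+m]-[+n]≡m⊖n a b))
                       (trans (ℤP.∣m⊖n∣≡∣n⊖m∣ a b) (ℤP.∣⊖∣-≤ b≤a))

    ∣diff∣′ : ∀ a b → a ≤ b → ℤ.∣ ℤ.+ a ℤ.- ℤ.+ b ∣ ≡ b ∸ a
    ∣diff∣′ a b a≤b = trans (cong ℤ.∣_∣ (ℤP.[+m]-[+n]≡m⊖n a b)) (ℤP.∣⊖∣-≤ a≤b)

  ≡mod⇒%≡ : ∀ {a b} → a ≡ b [mod n ] → a % n ≡ b % n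
  ≡mod⇒%≡ {a} {b} c with ≤-total b a
  ... | inj₁ b≤a = ∣∸⇒%≡ a b b≤a (subst (n ∣_) (∣diff∣ a b b≤a) c)
  ... | inj₂ a≤b = sym (∣∸⇒%≡ b a a≤b (subst (n ∣_) (∣diff∣′ a b a≤b) c))

  %≡⇒≡mod : ∀ {a b} → a % n ≡ b % n → a ≡ b [mod n ]
  %≡⇒≡mod {a} {b} eq with ≤-total b a
  ... | inj₁ b≤a = subst (n ∣_) (sym (∣diff∣ a b b≤a)) (%≡⇒∣∸ a b b≤a eq)
  ... | inj₂ a≤b = subst (n ∣_) (sym (∣diff∣′ a b a≤b)) (%≡⇒∣∸ b a a≤b (sym eq))

  %≡-*ʳ : ∀ {a b} c → a % n ≡ b % n → (a * c) % n ≡ (b * c) % n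
  %≡-*ʳ {a} {b} c eq = trans (%-distribˡ-* a c n)
    (trans (cong (λ x → (x * (c % n)) % n) eq) (sym (%-distribˡ-* b c n)))

  %≡-*ˡ : ∀ {a b} c → a % n ≡ b % n → (c * a) % n ≡ (c * b) % n
  %≡-*ˡ {a} {b} c eq = trans (cong (_% n) (*-comm c a))
    (trans (%≡-*ʳ c eq) (cong (_% n) (*-comm b c)))

  %≡-resp-∣ : ∀ {a b} → a % n ≡ b % n → n ∣ a → n ∣ b
  %≡-resp-∣ {a} {b} eq n∣a = m%n≡0⇒n∣m b n (trans (sym eq) (n∣m⇒m%n≡0 a n n∣a))

  ∣⇒%≡0 : ∀ {a} → n ∣ a → a % n ≡ 0 % n
  ∣⇒%≡0 {a} n∣a = trans (n∣m⇒m%n≡0 a n n∣a) (sym (0%n≡0 n))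
    where
    0%n≡0 : ∀ n .{{_ : NonZero n}} → 0 % n ≡ 0
    0%n≡0 (suc n) = refl

%≡-down : ∀ {c n a b} .{{_ : NonZero c}} .{{_ : NonZero n}} → c ∣ n → a % n ≡ b % n → a % c ≡ b % c
%≡-down {c} {n} {a} {b} c∣n eq =
  trans (sym (m∣n⇒o%n%m≡o%m c n a c∣n)) (trans (cong (_% c) eq) (m∣n⇒o%n%m≡o%m c n b c∣n))

Σ< : ℕ → (ℕ → ℕ) → ℕ
Σ< zero    f = 0
Σ< (suc n) f = f 0 + Σ< n (f ∘ suc)

ifB : Bool → ℕ → ℕ
ifB b x = if b then x else 0

Σ<-cong : ∀ n {f g} → (∀ v → v < n → f v ≡ g v) → Σ< n f ≡ Σ< n g
Σ<-cong zero    f≗g = refl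
Σ<-cong (suc n) f≗g = cong₂ _+_ (f≗g 0 z<s) (Σ<-cong n (λ v v<n → f≗g (suc v) (s<s v<n)))

Σ<-zero : ∀ n → Σ< n (λ _ → 0) ≡ 0
Σ<-zero zero    = refl
Σ<-zero (suc n) = Σ<-zero n

Σ<-+ : ∀ n f g → Σ< n (λ v → f v + g v) ≡ Σ< n f + Σ< n g
Σ<-+ zero    f g = refl
Σ<-+ (suc n) f g = trans (cong ((f 0 + g 0) +_) (Σ<-+ n (f ∘ suc) (g ∘ suc)))
                         (+-interchange (f 0) (g 0) (Σ< n (f ∘ suc)) (Σ< n (g ∘ suc)))

Σ<-* : ∀ n c f → Σ< n (λ v → c * f v) ≡ c * Σ< n f
Σ<-* zero    c f = sym (*-zeroʳ c)
Σ<-* (suc n) c f = trans (cong (c * f 0 +_) (Σ<-* n c (f ∘ suc))) (sym (*-distribˡ-+ c (f 0) _))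

Σ<-split : ∀ a b f → Σ< (a + b) f ≡ Σ< a f + Σ< b (λ v → f (a + v))
Σ<-split zero    b f = refl
Σ<-split (suc a) b f = trans (cong (f 0 +_) (Σ<-split a b (f ∘ suc))) (sym (+-assoc (f 0) _ _))

Σ<-snoc : ∀ n f → Σ< (suc n) f ≡ Σ< n f + f n
Σ<-snoc zero    f = +-comm (f 0) 0
Σ<-snoc (suc n) f = trans (cong (f 0 +_) (Σ<-snoc n (f ∘ suc))) (sym (+-assoc (f 0) _ _))

private
  1+[n∸[1+v]]≡n∸v : ∀ v n → v < n → suc (n ∸ suc v) ≡ n ∸ v
  1+[n∸[1+v]]≡n∸v zero    (suc n) _         = refl
  1+[n∸[1+v]]≡n∸v (suc v) (suc n) (s≤s v<n) = 1+[n∸[1+v]]≡n∸v v n v<n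

Σ<-reverse : ∀ n f → Σ< n f ≡ Σ< n (λ v → f (n ∸ suc v))
Σ<-reverse zero    f = refl
Σ<-reverse (suc n) f = begin
  f 0 + Σ< n (f ∘ suc)                    ≡⟨ cong (f 0 +_) (Σ<-reverse n (f ∘ suc)) ⟩
  f 0 + Σ< n (λ v → f (suc (n ∸ suc v)))  ≡⟨ cong (f 0 +_) (Σ<-cong n (λ v v<n → cong f (1+[n∸[1+v]]≡n∸v v n v<n))) ⟩
  f 0 + Σ< n (λ v → f (n ∸ v))            ≡⟨ +-comm (f 0) _ ⟩
  Σ< n (λ v → f (n ∸ v)) + f 0            ≡⟨ cong (λ x → Σ< n (λ v → f (n ∸ v)) + f x) (n∸n≡0 n) ⟨
  Σ< n (λ v → f (n ∸ v)) + f (n ∸ n)      ≡⟨ Σ<-snoc n (λ v → f (n ∸ v)) ⟨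
  Σ< (suc n) (λ v → f (n ∸ v))            ∎
  where open ≡-Reasoning

Σ<-periodic : ∀ k n f → (∀ v → f (n + v) ≡ f v) → Σ< (k * n) f ≡ k * Σ< n f
Σ<-periodic zero    n f per = refl
Σ<-periodic (suc k) n f per = begin
  Σ< (n + k * n) f                         ≡⟨ Σ<-split n (k * n) f ⟩
  Σ< n f + Σ< (k * n) (λ v → f (n + v))    ≡⟨ cong (Σ< n f +_) (Σ<-cong (k * n) (λ v _ → per v)) ⟩
  Σ< n f + Σ< (k * n) f                    ≡⟨ cong (Σ< n f +_) (Σ<-periodic k n f per) ⟩
  Σ< n f + k * Σ< n f                      ∎
  where open ≡-Reasoning

Σ<-multiples : ∀ N c .{{_ : NonZero c}} (h : ℕ → ℕ) →
  Σ< (N * c) (λ v → if does (c ∣? v) then h v else 0) ≡ Σ< N (λ w → h (w * c))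
Σ<-multiples zero    c h = refl
Σ<-multiples (suc N) c h = begin
  Σ< (c + N * c) F                                                 ≡⟨ Σ<-split c (N * c) F ⟩
  Σ< c F + Σ< (N * c) (λ v → F (c + v))                            ≡⟨ cong₂ _+_ (firstBlock c refl) (Σ<-cong (N * c) (λ v _ → shift v)) ⟩
  h 0 + Σ< (N * c) (λ v → if does (c ∣? v) then h (c + v) else 0)  ≡⟨ cong (h 0 +_) (Σ<-multiples N c (λ v → h (c + v))) ⟩
  h 0 + Σ< N (λ w → h (c + w * c))                                 ∎
  where
  open ≡-Reasoning
  F : ℕ → ℕ
  F v = if does (c ∣? v) then h v else 0
  shift : ∀ v → F (c + v) ≡ (if does (c ∣? v) then h (c + v) else 0)
  shift v with c ∣? (c + v) | c ∣? v
  ... | yes _ | yes _ = refl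
  ... | no  _ | no  _ = refl
  ... | yes c∣c+v | no c∤v = ⊥-elim (c∤v (∣m+n∣m⇒∣n c∣c+v ∣-refl))
  ... | no c∤c+v | yes c∣v = ⊥-elim (c∤c+v (∣m∣n⇒∣m+n ∣-refl c∣v))
  -- among 0, …, c − 1 only 0 is a multiple of c
  firstBlock : ∀ c′ → c′ ≡ c → Σ< c′ F ≡ h 0
  firstBlock zero     eq = ⊥-elim (≢-nonZero⁻¹ c (sym eq))
  firstBlock (suc c′) eq =
    trans (cong₂ _+_ F0 (trans (Σ<-cong c′ Fsuc) (Σ<-zero c′))) (+-identityʳ (h 0))
    where
    F0 : F 0 ≡ h 0
    F0 with c ∣? 0
    ... | yes _   = refl
    ... | no  c∤0 = ⊥-elim (c∤0 (c ∣0))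
    Fsuc : ∀ v → v < c′ → F (suc v) ≡ 0
    Fsuc v v<c′ with c ∣? suc v
    ... | no  _ = refl
    ... | yes c∣sv = ⊥-elim (<⇒≱ (subst (suc v <_) eq (s<s v<c′)) (∣⇒≤ c∣sv))

Σ<-symmetric : ∀ n (B : ℕ → Bool) → B 0 ≡ false → (∀ v → 0 < v → v < n → B v ≡ B (n ∸ v)) →
  2 * Σ< n (λ v → ifB (B v) v) ≡ n * Σ< n (λ v → ifB (B v) 1)
Σ<-symmetric zero    B B0 sym-B = refl
Σ<-symmetric (suc n) B B0 sym-B rewrite B0 = begin
  2 * s                                                          ≡⟨ cong (s +_) (+-identityʳ s) ⟩
  s + s                                                          ≡⟨ cong (s +_) reversed ⟩
  s + Σ< n (λ u → ifB (B (suc u)) (n ∸ u))                       ≡⟨ Σ<-+ n _ _ ⟨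
  Σ< n (λ u → ifB (B (suc u)) (suc u) + ifB (B (suc u)) (n ∸ u)) ≡⟨ Σ<-cong n pair ⟩
  Σ< n (λ u → suc n * ifB (B (suc u)) 1)                         ≡⟨ Σ<-* n (suc n) _ ⟩
  suc n * Σ< n (λ u → ifB (B (suc u)) 1)                         ∎
  where
  open ≡-Reasoning
  s : ℕ
  s = Σ< n (λ u → ifB (B (suc u)) (suc u))
  reversed : s ≡ Σ< n (λ u → ifB (B (suc u)) (n ∸ u))
  reversed = trans (Σ<-reverse n (λ u → ifB (B (suc u)) (suc u)))
    (Σ<-cong n (λ u u<n → trans (cong (λ x → ifB (B x) x) (1+[n∸[1+v]]≡n∸v u n u<n))
                                (cong (λ b → ifB b (n ∸ u)) (sym (sym-B (suc u) z<s (s<s u<n))))))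
  pair : ∀ u → u < n → ifB (B (suc u)) (suc u) + ifB (B (suc u)) (n ∸ u) ≡ suc n * ifB (B (suc u)) 1
  pair u u<n with B (suc u)
  ... | false = sym (*-zeroʳ n)
  ... | true  = trans (cong suc (m+[n∸m]≡n (<⇒≤ u<n))) (sym (*-identityʳ (suc n)))

module _ {a b} {A : Set a} {B : Set b} where

  ifB-×-dec : (A? : Dec A) (B? : Dec B) → ifB (does (A? ×-dec B?)) 1 ≡ (if does A? then ifB (does B?) 1 else 0)
  ifB-×-dec (yes _) _ = refl
  ifB-×-dec (no  _) _ = refl

  ifB-partition : ∀ {c} {C : Set c} → (A? : Dec A) (B? : Dec B) (C? : Dec C) → (C → A) →
    ifB (does (A? ×-dec B?)) 1 ≡ ifB (does ((A? ×-dec B?) ×-dec ¬? C?)) 1 + ifB (does (C? ×-dec B?)) 1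
  ifB-partition (yes _) (yes _) (yes _) _   = refl
  ifB-partition (yes _) (yes _) (no  _) _   = refl
  ifB-partition (yes _) (no  _) (yes _) _   = refl
  ifB-partition (yes _) (no  _) (no  _) _   = refl
  ifB-partition (no ¬a) (yes _) (yes c) C→A = ⊥-elim (¬a (C→A c))
  ifB-partition (no  _) (yes _) (no  _) _   = refl
  ifB-partition (no  _) (no  _) (yes _) _   = refl
  ifB-partition (no  _) (no  _) (no  _) _   = refl

module _ {ℓ} {P : Pred ℕ ℓ} (P? : Decidable P) where

  sum-filter : ∀ g n → sum (filter P? (applyUpTo g n)) ≡ Σ< n (λ v → ifB (does (P? (g v))) (g v))
  sum-filter g zero = refl
  sum-filter g (suc n) with does (P? (g 0))
  ... | true  = cong (g 0 +_) (sum-filter (g ∘ suc) n)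
  ... | false = sum-filter (g ∘ suc) n

  length-filter : ∀ g n → length (filter P? (applyUpTo g n)) ≡ Σ< n (λ v → ifB (does (P? (g v))) 1)
  length-filter g zero = refl
  length-filter g (suc n) with does (P? (g 0))
  ... | true  = cong suc (length-filter (g ∘ suc) n)
  ... | false = length-filter (g ∘ suc) n

sum-enumeration : ∀ {ℓ} {P : Pred ℕ ℓ} (P? : Decidable P) n (L : List ℕ) → Unique L →
  (∀ v → v ∈ L ⇔ (v < n × P v)) → sum L ≡ Σ< n (λ v → ifB (does (P? v)) v)
sum-enumeration P? n L unique L⇔ =
  trans (sum-↭ (∼bag⇒↭ (unique∧set⇒bag unique (filter⁺ P? (upTo⁺ n)) L⇔filter))) (sum-filter P? id n)
  where
  L⇔filter : ∀ {v} → v ∈ L ⇔ v ∈ filter P? (upTo n)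
  L⇔filter {v} = mk⇔
    (λ v∈L → let (v<n , Pv) = Equivalence.to (L⇔ v) v∈L in ∈-filter⁺ P? (∈-upTo⁺ v<n) Pv)
    (λ v∈filter → let (v∈upTo , Pv) = ∈-filter⁻ P? v∈filter in Equivalence.from (L⇔ v) (∈-upTo⁻ v∈upTo , Pv))

+-as-difference : ∀ {a b c} → a + c ≡ b → ℤ.+ a ≡ ℤ.+ b ℤ.- ℤ.+ c
+-as-difference {a} {b} {c} a+c≡b = begin
  ℤ.+ a               ≡⟨ cong ℤ.+_ (trans (sym (m+n∸n≡m a c)) (cong (_∸ c) a+c≡b)) ⟩
  ℤ.+ (b ∸ c)         ≡⟨ ℤP.⊖-≥ c≤b ⟨
  b ℤ.⊖ c             ≡⟨ ℤP.[+m]-[+n]≡m⊖n b c ⟨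
  ℤ.+ b ℤ.- ℤ.+ c     ∎
  where
  open ≡-Reasoning
  c≤b : c ≤ b
  c≤b = subst (c ≤_) a+c≡b (m≤n+m c a)

∏-cong : ∀ {r} {f g : Fin r → ℕ} → (∀ j → f j ≡ g j) → ∏ f ≡ ∏ g
∏-cong {zero}  f≗g = refl
∏-cong {suc r} f≗g = cong₂ _*_ (f≗g zero) (∏-cong (f≗g ∘ suc))

∏-* : ∀ {r} (f g : Fin r → ℕ) → ∏ (λ j → f j * g j) ≡ ∏ f * ∏ g
∏-* {zero}  f g = refl
∏-* {suc r} f g = trans (cong ((f zero * g zero) *_) (∏-* (f ∘ suc) (g ∘ suc)))
                        (*-interchange (f zero) (g zero) (∏ (f ∘ suc)) (∏ (g ∘ suc)))

∏-mono-∣ : ∀ {r} {f g : Fin r → ℕ} → (∀ j → f j ∣ g j) → ∏ f ∣ ∏ g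
∏-mono-∣ {zero}  f∣g = ∣-refl
∏-mono-∣ {suc r} f∣g = *-pres-∣ (f∣g zero) (∏-mono-∣ (f∣g ∘ suc))

factor∣∏ : ∀ {r} (f : Fin r → ℕ) j → f j ∣ ∏ f
factor∣∏ f zero    = m∣m*n _
factor∣∏ f (suc j) = ∣n⇒∣m*n (f zero) (factor∣∏ (f ∘ suc) j)

prime≢1 : ∀ {q} → Prime q → q ≢ 1
prime≢1 (prime ⦃ nt ⦄ _) = nonTrivial⇒≢1 ⦃ nt ⦄

prime∣∏ : ∀ {r q} (f : Fin r → ℕ) → Prime q → q ∣ ∏ f → ∃ λ j → q ∣ f j
prime∣∏ {zero}  f q-prime q∣1 = ⊥-elim (prime≢1 q-prime (∣1⇒≡1 q∣1))
prime∣∏ {suc r} f q-prime q∣∏ with euclidsLemma (f zero) (∏ (f ∘ suc)) q-prime q∣∏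
... | inj₁ q∣f0 = zero , q∣f0
... | inj₂ q∣rest = let (j , q∣fj) = prime∣∏ (f ∘ suc) q-prime q∣rest in suc j , q∣fj

prime∣^ : ∀ {q a} k → Prime q → q ∣ a ^ k → q ∣ a
prime∣^         zero    q-prime q∣1 = ⊥-elim (prime≢1 q-prime (∣1⇒≡1 q∣1))
prime∣^ {q} {a} (suc k) q-prime q∣a^sk with euclidsLemma a (a ^ k) q-prime q∣a^sk
... | inj₁ q∣a   = q∣a
... | inj₂ q∣a^k = prime∣^ k q-prime q∣a^k

prime∣prime : ∀ {q p} → Prime q → Prime p → q ∣ p → q ≡ p
prime∣prime q-prime p-prime q∣p with prime⇒irreducible p-prime q∣p
... | inj₁ q≡1 = ⊥-elim (prime≢1 q-prime q≡1)
... | inj₂ q≡p = q≡p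

prime∤⇒coprime : ∀ {p n} → Prime p → ¬ p ∣ n → Coprime p n
prime∤⇒coprime p-prime p∤n (d∣p , d∣n) with prime⇒irreducible p-prime d∣p
... | inj₁ d≡1 = d≡1
... | inj₂ refl = ⊥-elim (p∤n d∣n)

coprime-1 : ∀ a → Coprime a 1
coprime-1 a (_ , d∣1) = ∣1⇒≡1 d∣1

coprime-* : ∀ {a b c} → Coprime a b → Coprime a c → Coprime a (b * c)
coprime-* {a} {b} {c} a⊥b a⊥c {d} (d∣a , d∣bc) = a⊥c (d∣a , coprime-divisor d⊥b d∣bc)
  where
  d⊥b : Coprime d b
  d⊥b (e∣d , e∣b) = a⊥b (∣-trans e∣d d∣a , e∣b)

coprime-^ : ∀ {a b} k → Coprime a b → Coprime a (b ^ k)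
coprime-^ zero    a⊥b = coprime-1 _
coprime-^ (suc k) a⊥b = coprime-* a⊥b (coprime-^ k a⊥b)

coprime-∣⇒*∣ : ∀ {u w x} → Coprime u w → u ∣ x → w ∣ x → u * w ∣ x
coprime-∣⇒*∣ {u} {w} {x} u⊥w (divides k x≡ku) w∣x =
  subst (u * w ∣_) (trans (*-comm u k) (sym x≡ku)) (*-monoʳ-∣ u w∣k)
  where
  w∣k : w ∣ k
  w∣k = coprime-divisor (Coprimality.sym u⊥w) (subst (w ∣_) (trans x≡ku (*-comm k u)) w∣x)

^-mono-∣ : ∀ {a b} k → a ∣ b → a ^ k ∣ b ^ k
^-mono-∣ zero    a∣b = ∣-refl
^-mono-∣ (suc k) a∣b = *-pres-∣ a∣b (^-mono-∣ k a∣b)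

^-∣-^ : ∀ p {a b} → a ≤ b → p ^ a ∣ p ^ b
^-∣-^ p {a} {b} a≤b =
  divides (p ^ (b ∸ a)) (trans (cong (p ^_) (sym (m∸n+n≡m a≤b))) (^-distribˡ-+-* p (b ∸ a) a))

∣^suc : ∀ a k → a ∣ a ^ suc k
∣^suc a k = m∣m*n _

∣∸⇔ : ∀ {c n v} → c ∣ n → v ≤ n → c ∣ n ∸ v ⇔ c ∣ v
∣∸⇔ c∣n v≤n = mk⇔
  (∣m+n∣m⇒∣n (subst (_ ∣_) (sym (m∸n+n≡m v≤n)) c∣n))
  (∣m+n∣m⇒∣n (subst (_ ∣_) (sym (m+[n∸m]≡n v≤n)) c∣n))

∏pow : ∀ {r} → (Fin r → ℕ) → (Fin r → ℕ) → ℕ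
∏pow p a = ∏ (λ j → p j ^ a j)

∏pow≢0 : ∀ {r} (p a : Fin r → ℕ) → (∀ i → Prime (p i)) → NonZero (∏pow p a)
∏pow≢0 {zero}  p a primes = _
∏pow≢0 {suc r} p a primes =
  m*n≢0 _ _ {{m^n≢0 (p zero) (a zero) {{prime⇒nonZero (primes zero)}}}}
            {{∏pow≢0 (p ∘ suc) (a ∘ suc) (primes ∘ suc)}}

prime∣∏pow : ∀ {r q} (p a : Fin r → ℕ) → (∀ i → Prime (p i)) → Prime q → q ∣ ∏pow p a →
  ∃ λ j → q ≡ p j × 0 < a j
prime∣∏pow p a primes q-prime q∣∏ with prime∣∏ (λ j → p j ^ a j) q-prime q∣∏
... | j , q∣pj^aj with a j in aj≡
... | zero  = ⊥-elim (prime≢1 q-prime (∣1⇒≡1 q∣pj^aj))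
... | suc k = j , prime∣prime q-prime (primes j) (prime∣^ (suc k) q-prime q∣pj^aj)
                , subst (0 <_) (sym aj≡) z<s

p∤∏pow : ∀ {r} (p a : Fin r → ℕ) → (∀ i → Prime (p i)) → Injective _≡_ _≡_ p →
  ∀ j → a j ≡ 0 → ¬ p j ∣ ∏pow p a
p∤∏pow p a primes p-inj j aj≡0 pj∣∏ with prime∣∏pow p a primes (primes j) pj∣∏
... | k , pj≡pk , 0<ak with p-inj pj≡pk
... | refl = <-irrefl (sym aj≡0) 0<ak

∏pow-∣ : ∀ {r} (p a : Fin r → ℕ) → (∀ i → Prime (p i)) → Injective _≡_ _≡_ p →
  ∀ {x} → (∀ j → p j ^ a j ∣ x) → ∏pow p a ∣ x
∏pow-∣ {zero}  p a primes p-inj pow∣x = 1∣ _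
∏pow-∣ {suc r} p a primes p-inj pow∣x = coprime-∣⇒*∣ head⊥rest (pow∣x zero)
  (∏pow-∣ (p ∘ suc) (a ∘ suc) (primes ∘ suc) (λ eq → Fin.suc-injective (p-inj eq)) (pow∣x ∘ suc))
  where
  p0∤rest : ¬ p zero ∣ ∏pow (p ∘ suc) (a ∘ suc)
  p0∤rest p0∣rest with prime∣∏pow (p ∘ suc) (a ∘ suc) (primes ∘ suc) (primes zero) p0∣rest
  ... | j , p0≡psj , _ with p-inj p0≡psj
  ... | ()
  head⊥rest : Coprime (p zero ^ a zero) (∏pow (p ∘ suc) (a ∘ suc))
  head⊥rest = Coprimality.sym (coprime-^ (a zero) (Coprimality.sym (prime∤⇒coprime (primes zero) p0∤rest)))

coprime-∏pow : ∀ {r} (p a : Fin r → ℕ) → (∀ i → Prime (p i)) →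
  ∀ {w} → (∀ j → 0 < a j → ¬ p j ∣ w) → Coprime w (∏pow p a)
coprime-∏pow {zero}  p a primes p∤w = coprime-1 _
coprime-∏pow {suc r} p a primes {w} p∤w =
  coprime-* w⊥head (coprime-∏pow (p ∘ suc) (a ∘ suc) (primes ∘ suc) (p∤w ∘ suc))
  where
  w⊥head : Coprime w (p zero ^ a zero)
  w⊥head with a zero in a0≡
  ... | zero  = coprime-1 w
  ... | suc k = coprime-^ (suc k)
    (Coprimality.sym (prime∤⇒coprime (primes zero) (p∤w zero (subst (0 <_) (sym a0≡) z<s))))

coprime-∏pow⁻ : ∀ {r} (p a : Fin r → ℕ) → (∀ i → Prime (p i)) →
  ∀ {w} → Coprime w (∏pow p a) → ∀ j → 0 < a j → ¬ p j ∣ w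
coprime-∏pow⁻ p a primes w⊥∏ j 0<aj pj∣w =
  prime≢1 (primes j) (w⊥∏ (pj∣w , ∣-trans (pj∣pj^aj (a j) 0<aj) (factor∣∏ (λ j → p j ^ a j) j)))
  where
  pj∣pj^aj : ∀ k → 0 < k → p j ∣ p j ^ k
  pj∣pj^aj (suc k) _ = ∣^suc (p j) k

-- Every residue v has an idempotent power v^K, K ≥ 1 (pigeonhole on v, v², …, v^{n+1}).
module IdempotentPowers (n : ℕ) .{{_ : NonZero n}} where
  open Remainders n

  periodic-from : ∀ v s t → (v ^ (s + t)) % n ≡ (v ^ s) % n →
    ∀ x k → (v ^ (s + x + k * t)) % n ≡ (v ^ (s + x)) % n
  periodic-from v s t period x zero = cong (λ y → (v ^ y) % n) (+-identityʳ (s + x))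
  periodic-from v s t period x (suc k) = begin
    (v ^ (s + x + (t + k * t))) % n   ≡⟨ cong (λ y → (v ^ y) % n) (+-interchange s x t (k * t)) ⟩
    (v ^ (s + t + (x + k * t))) % n   ≡⟨ cong (_% n) (^-distribˡ-+-* v (s + t) (x + k * t)) ⟩
    (v ^ (s + t) * v ^ (x + k * t)) % n ≡⟨ %≡-*ʳ (v ^ (x + k * t)) period ⟩
    (v ^ s * v ^ (x + k * t)) % n     ≡⟨ cong (_% n) (^-distribˡ-+-* v s (x + k * t)) ⟨
    (v ^ (s + (x + k * t))) % n       ≡⟨ cong (λ y → (v ^ y) % n) (+-assoc s x (k * t)) ⟨
    (v ^ (s + x + k * t)) % n         ≡⟨ periodic-from v s t period x k ⟩
    (v ^ (s + x)) % n                 ∎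
    where open ≡-Reasoning

  idempotent-power : ∀ v → ∃ λ K → 1 ≤ K × (v ^ K * v ^ K) % n ≡ (v ^ K) % n
  idempotent-power v with Fin.pigeonhole (n<1+n n) (λ i → fromℕ< (m%n<n (v ^ suc (toℕ i)) n))
  ... | i , j , i<j , same = s + s * t′ , s≤s z≤n , idempotent
    where
    s t t′ : ℕ
    s = suc (toℕ i)
    t = toℕ j ∸ toℕ i
    t′ = pred t
    t≡1+t′ : t ≡ suc t′
    t≡1+t′ = sym (suc-pred t {{>-nonZero (m<n⇒0<n∸m i<j)}})
    period : (v ^ (s + t)) % n ≡ (v ^ s) % n
    period = begin
      (v ^ (s + t)) % n                    ≡⟨ cong (λ y → (v ^ suc y) % n) (m+[n∸m]≡n (<⇒≤ i<j)) ⟩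
      (v ^ suc (toℕ j)) % n                ≡⟨ Fin.toℕ-fromℕ< (m%n<n (v ^ suc (toℕ j)) n) ⟨
      toℕ (fromℕ< (m%n<n (v ^ suc (toℕ j)) n)) ≡⟨ cong toℕ same ⟨
      toℕ (fromℕ< (m%n<n (v ^ s) n))       ≡⟨ Fin.toℕ-fromℕ< (m%n<n (v ^ s) n) ⟩
      (v ^ s) % n                          ∎
      where open ≡-Reasoning
    K : ℕ
    K = s + s * t′
    idempotent : (v ^ K * v ^ K) % n ≡ (v ^ K) % n
    idempotent = begin
      (v ^ K * v ^ K) % n          ≡⟨ cong (_% n) (^-distribˡ-+-* v K K) ⟨
      (v ^ (K + K)) % n            ≡⟨ cong (λ y → (v ^ (K + y)) % n) (trans (cong (s *_) t≡1+t′) (*-suc s t′)) ⟨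
      (v ^ (K + s * t)) % n        ≡⟨ periodic-from v s t period (s * t′) s ⟩
      (v ^ K) % n                  ∎
      where open ≡-Reasoning

  idempotent-^ : ∀ {x} → (x * x) % n ≡ x % n → ∀ k → (x ^ suc k) % n ≡ x % n
  idempotent-^ {x} idem zero    = cong (_% n) (*-identityʳ x)
  idempotent-^ {x} idem (suc k) = trans (%≡-*ˡ x (idempotent-^ idem k)) idem

-- Restricting a product to a subset J; the quantities of Defs are πS p J = ∏[ J ] p and
-- gS p e J = ∏[ J ] (p^e).  As prime-power products, the latter has exponents select J e.
∏[_] : ∀ {r} → Subset r → (Fin r → ℕ) → ℕ
∏[ J ] f = ∏ (λ j → if lookup J j then f j else 1)

select : ∀ {r} → Subset r → (Fin r → ℕ) → Fin r → ℕ
select J a j = if lookup J j then a j else 0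

lookup-∁ : ∀ {r} (J : Subset r) j → lookup (∁ J) j ≡ not (lookup J j)
lookup-∁ J j = lookup-map j not J

∈∁⇒∉ : ∀ {r} (J : Subset r) j → lookup (∁ J) j ≡ true → lookup J j ≡ false
∈∁⇒∉ J j j∈∁J with lookup J j | lookup-∁ J j
... | false | _     = refl
... | true  | j∉∁J with trans (sym j∈∁J) j∉∁J
...   | ()

∏[⊤] : ∀ {r} (f : Fin r → ℕ) → ∏[ ⊤ ] f ≡ ∏ f
∏[⊤] f = ∏-cong (λ j → cong (λ b → if b then f j else 1) (lookup-replicate j true))

∏[]-split : ∀ {r} (J : Subset r) (f : Fin r → ℕ) → ∏ f ≡ ∏[ J ] f * ∏[ ∁ J ] f
∏[]-split J f = trans (∏-cong split) (∏-* (λ j → if lookup J j then f j else 1) (λ j → if lookup (∁ J) j then f j else 1))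
  where
  split : ∀ j → f j ≡ (if lookup J j then f j else 1) * (if lookup (∁ J) j then f j else 1)
  split j rewrite lookup-∁ J j with lookup J j
  ... | true  = sym (*-identityʳ (f j))
  ... | false = sym (+-identityʳ (f j))

∏[]-mono-∣ : ∀ {r} (J : Subset r) {f g : Fin r → ℕ} → (∀ j → f j ∣ g j) → ∏[ J ] f ∣ ∏[ J ] g
∏[]-mono-∣ J {f} {g} f∣g = ∏-mono-∣ pointwise
  where
  pointwise : ∀ j → (if lookup J j then f j else 1) ∣ (if lookup J j then g j else 1)
  pointwise j with lookup J j
  ... | true  = f∣g j
  ... | false = ∣-refl

factor∣∏[] : ∀ {r} (J : Subset r) (f : Fin r → ℕ) j → lookup J j ≡ true → f j ∣ ∏[ J ] f
factor∣∏[] J f j j∈J = subst (_∣ ∏[ J ] f) (cong (λ b → if b then f j else 1) j∈J)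
                         (factor∣∏ (λ j → if lookup J j then f j else 1) j)

∏[]-pow : ∀ {r} (J : Subset r) (p a : Fin r → ℕ) → ∏[ J ] (λ j → p j ^ a j) ≡ ∏pow p (select J a)
∏[]-pow J p a = ∏-cong pointwise
  where
  pointwise : ∀ j → (if lookup J j then p j ^ a j else 1) ≡ p j ^ select J a j
  pointwise j with lookup J j
  ... | true  = refl
  ... | false = refl

∏[]-^1 : ∀ {r} (J : Subset r) (p : Fin r → ℕ) → ∏[ J ] p ≡ ∏[ J ] (λ j → p j ^ 1)
∏[]-^1 J p = ∏-cong pow1
  where
  pow1 : ∀ j → (if lookup J j then p j else 1) ≡ (if lookup J j then p j ^ 1 else 1)
  pow1 j with lookup J j
  ... | true  = sym (*-identityʳ (p j))
  ... | false = refl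

module Setting (r : ℕ) (p e : Fin r → ℕ) (primes : ∀ i → Prime (p i)) (p-inj : Injective _≡_ _≡_ p)
               (e≥1 : ∀ i → 1 ≤ e i) (I : Subset r) where

  m : ℕ
  m = modulus p e

  q : Fin r → ℕ
  q j = p j ^ e j

  instance
    m≢0 : NonZero m
    m≢0 = ∏pow≢0 p e primes

    p≢0 : {j : Fin r} → NonZero (p j)
    p≢0 {j} = prime⇒nonZero (primes j)

    q≢0 : {j : Fin r} → NonZero (p j ^ e j)
    q≢0 {j} = m^n≢0 (p j) (e j)

  open Remainders m
  open IdempotentPowers m

  p∣q : ∀ j → p j ∣ q j
  p∣q j with e j | e≥1 j
  ... | suc k | _ = ∣^suc (p j) k

  q∣m : ∀ j → q j ∣ m
  q∣m = factor∣∏ q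

  p∣m : ∀ j → p j ∣ m
  p∣m j = ∣-trans (p∣q j) (q∣m j)

  crt : ∀ {x y} → (∀ j → x % q j ≡ y % q j) → x % m ≡ y % m
  crt {x} {y} x≡y with ≤-total y x
  ... | inj₁ y≤x = ∣∸⇒%≡ x y y≤x (∏pow-∣ p e primes p-inj (λ j → Remainders.%≡⇒∣∸ (q j) x y y≤x (x≡y j)))
  ... | inj₂ x≤y = sym (∣∸⇒%≡ y x x≤y (∏pow-∣ p e primes p-inj (λ j → Remainders.%≡⇒∣∸ (q j) y x x≤y (sym (x≡y j)))))

  module _ (J : Subset r) (a : Fin r → ℕ) where

    ∏[]-pow≢0 : NonZero (∏[ J ] (λ j → p j ^ a j))
    ∏[]-pow≢0 = subst NonZero (sym (∏[]-pow J p a)) (∏pow≢0 p (select J a) primes)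

    coprime-∏[]⇔ : (∀ j → 0 < a j) → ∀ w →
      gcd w (∏[ J ] (λ j → p j ^ a j)) ≡ 1 ⇔ (∀ j → lookup J j ≡ true → ¬ p j ∣ w)
    coprime-∏[]⇔ a>0 w = mk⇔
      (λ gcd≡1 j j∈J → coprime-∏pow⁻ p (select J a) primes
         (subst (Coprime w) (∏[]-pow J p a) (Coprimality.gcd≡1⇒coprime gcd≡1)) j (positive j j∈J))
      (λ p∤w → Coprimality.coprime⇒gcd≡1 (subst (Coprime w) (sym (∏[]-pow J p a))
         (coprime-∏pow p (select J a) primes (λ j 0<aj → p∤w j (inJ j 0<aj)))))
      where
      positive : ∀ j → lookup J j ≡ true → 0 < select J a j
      positive j j∈J rewrite j∈J = a>0 j
      inJ : ∀ j → 0 < select J a j → lookup J j ≡ true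
      inJ j 0<aj with lookup J j
      ... | true = refl

    p∤∏[] : ∀ j → lookup J j ≡ false → ¬ p j ∣ ∏[ J ] (λ j → p j ^ a j)
    p∤∏[] j j∉J = subst (λ x → ¬ p j ∣ x) (sym (∏[]-pow J p a))
                    (p∤∏pow p (select J a) primes p-inj j (cong (λ b → if b then a j else 0) j∉J))

    ∏[]-∣ : ∀ {x} → (∀ j → lookup J j ≡ true → p j ^ a j ∣ x) → ∏[ J ] (λ j → p j ^ a j) ∣ x
    ∏[]-∣ {x} pow∣x = subst (_∣ x) (sym (∏[]-pow J p a)) (∏pow-∣ p (select J a) primes p-inj factor∣x)
      where
      factor∣x : ∀ j → p j ^ select J a j ∣ x
      factor∣x j with lookup J j in j∈J
      ... | true  = pow∣x j j∈J
      ... | false = 1∣ x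

  gI g∁ πI π∁ πR : ℕ
  gI = gS p e I
  g∁ = gS p e (∁ I)
  πI = πS p I
  π∁ = πS p (∁ I)
  πR = πS p ⊤

  instance
    gI≢0 : NonZero gI
    gI≢0 = ∏[]-pow≢0 I e
    πI≢0 : NonZero πI
    πI≢0 = subst NonZero (sym (∏[]-^1 I p)) (∏[]-pow≢0 I (λ _ → 1))

  m≡gI*g∁ : m ≡ gI * g∁
  m≡gI*g∁ = ∏[]-split I q

  πR≡πI*π∁ : πR ≡ πI * π∁
  πR≡πI*π∁ = trans (∏[⊤] p) (∏[]-split I p)

  πR∣m : πR ∣ m
  πR∣m = subst (_∣ m) (sym (∏[⊤] p)) (∏-mono-∣ p∣q)

  πI∣gI : πI ∣ gI
  πI∣gI = ∏[]-mono-∣ I p∣q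

  gI∣m : gI ∣ m
  gI∣m = subst (gI ∣_) (sym m≡gI*g∁) (m∣m*n g∁)

  πI∣m : πI ∣ m
  πI∣m = ∣-trans πI∣gI gI∣m

  -- Avoids w: no prime p_j with j ∉ I divides w.  Being coprime to π_{∁I} and to g_{∁I} both
  -- mean exactly this.
  Avoids : ℕ → Set
  Avoids w = ∀ j → lookup (∁ I) j ≡ true → ¬ p j ∣ w

  coprime-π∁⇔ : ∀ w → gcd w π∁ ≡ 1 ⇔ Avoids w
  coprime-π∁⇔ w = subst (λ x → gcd w x ≡ 1 ⇔ Avoids w) (sym (∏[]-^1 (∁ I) p))
                    (coprime-∏[]⇔ (∁ I) (λ _ → 1) (λ _ → z<s) w)

  coprime-g∁⇔ : ∀ w → gcd w g∁ ≡ 1 ⇔ Avoids w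
  coprime-g∁⇔ w = coprime-∏[]⇔ (∁ I) e e≥1 w

  avoids-resp : ∀ {x y} → (∀ j → lookup (∁ I) j ≡ true → p j ∣ x → p j ∣ y) → Avoids y → Avoids x
  avoids-resp x→y y-avoids j j∈∁ pj∣x = y-avoids j j∈∁ (x→y j j∈∁ pj∣x)

  avoids-* : ∀ {x y} → Avoids x → Avoids y → Avoids (x * y)
  avoids-* {x} {y} x-avoids y-avoids j j∈∁ pj∣xy with euclidsLemma x y (primes j) pj∣xy
  ... | inj₁ pj∣x = x-avoids j j∈∁ pj∣x
  ... | inj₂ pj∣y = y-avoids j j∈∁ pj∣y

  avoids-∏[I] : ∀ a → Avoids (∏[ I ] (λ j → p j ^ a j))
  avoids-∏[I] a j j∈∁ = p∤∏[] I a j (∈∁⇒∉ I j j∈∁)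

  ExactSupport : ℕ → Set
  ExactSupport v = ∀ j → (p j ∣ v → lookup I j ≡ true) × (lookup I j ≡ true → p j ∣ v)

  InComponent : ℕ → Set
  InComponent v = πI ∣ v × gcd v π∁ ≡ 1

  exactSupport⇒InComponent : ∀ {v} → ExactSupport v → InComponent v
  exactSupport⇒InComponent {v} support =
    subst (_∣ v) (sym (∏[]-^1 I p)) (∏[]-∣ I (λ _ → 1) (λ j j∈I → subst (_∣ v) (sym (*-identityʳ (p j))) (proj₂ (support j) j∈I)))
    , Equivalence.from (coprime-π∁⇔ v) avoids
    where
    avoids : Avoids v
    avoids j j∈∁ pj∣v with trans (sym (proj₁ (support j) pj∣v)) (∈∁⇒∉ I j j∈∁)
    ... | ()

  InComponent⇒exactSupport : ∀ {v} → InComponent v → ExactSupport v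
  InComponent⇒exactSupport {v} (πI∣v , gcd≡1) j = p∣v⇒j∈I , λ j∈I → ∣-trans (factor∣∏[] I p j j∈I) πI∣v
    where
    p∣v⇒j∈I : p j ∣ v → lookup I j ≡ true
    p∣v⇒j∈I pj∣v with lookup I j in j∈?I
    ... | true  = refl
    ... | false = ⊥-elim (Equivalence.to (coprime-π∁⇔ v) gcd≡1 j (trans (lookup-∁ I j) (cong not j∈?I)) pj∣v)

  p∣-cong : ∀ j {x y} → x ≡ y [mod m ] → p j ∣ x ⇔ p j ∣ y
  p∣-cong j {x} {y} x≡y = mk⇔ (Remainders.%≡-resp-∣ (p j) x≡y[p]) (Remainders.%≡-resp-∣ (p j) (sym x≡y[p]))
    where
    x≡y[p] : x % p j ≡ y % p j
    x≡y[p] = %≡-down (p∣m j) (≡mod⇒%≡ x≡y)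

  p∣^⇔ : ∀ j a i → 1 ≤ i → p j ∣ a ^ i ⇔ p j ∣ a
  p∣^⇔ j a (suc i) _ = mk⇔ (prime∣^ (suc i) (primes j)) (λ pj∣a → ∣-trans pj∣a (∣^suc a i))

  exactSupport-^ : ∀ {v} K → 1 ≤ K → ExactSupport v → ExactSupport (v ^ K)
  exactSupport-^ {v} K K≥1 support j =
    proj₁ (support j) ∘ Equivalence.to (p∣^⇔ j v K K≥1) , Equivalence.from (p∣^⇔ j v K K≥1) ∘ proj₂ (support j)

  p∣-edge : ∀ {b c} → SPEdge m b c → ∀ j → p j ∣ b ⇔ p j ∣ c
  p∣-edge (a , i , i≥1 , b≡a^i , c≡a^1+i) j =
    ⇔.trans (p∣-cong j b≡a^i) (⇔.trans (p∣^⇔ j a i i≥1)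
      (⇔.sym (⇔.trans (p∣-cong j c≡a^1+i) (p∣^⇔ j a (suc i) z<s))))

  p∣-connected : ∀ {x y} → SPConnected m x y → ∀ j → p j ∣ x ⇔ p j ∣ y
  p∣-connected ε                 j = ⇔.refl
  p∣-connected (fwd edge ◅ path) j = ⇔.trans (p∣-edge edge j) (p∣-connected path j)
  p∣-connected (bwd edge ◅ path) j = ⇔.trans (⇔.sym (p∣-edge edge j)) (p∣-connected path j)

  idempotent-p∣ : ∀ {u} → (u * u) % m ≡ u % m → ∀ j → p j ∣ u → u % q j ≡ 0 % q j
  idempotent-p∣ {u} idem j pj∣u =
    Remainders.∣⇒%≡0 (q j) (Remainders.%≡-resp-∣ (q j) (%≡-down (q∣m j) u^ej≡u) (^-mono-∣ (e j) pj∣u))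
    where
    u^ej≡u : (u ^ e j) % m ≡ u % m
    u^ej≡u = subst (λ k → (u ^ k) % m ≡ u % m) (suc-pred (e j) {{>-nonZero (e≥1 j)}})
                   (idempotent-^ idem (pred (e j)))

  idempotent-p∤ : ∀ {u} → (u * u) % m ≡ u % m → ∀ j → ¬ p j ∣ u → u % q j ≡ 1 % q j
  idempotent-p∤ {u} idem j pj∤u = Remainders.∣∸⇒%≡ (q j) u 1 u≥1 (coprime-divisor qj⊥u qj∣u[u∸1])
    where
    u≥1 : 1 ≤ u
    u≥1 = n≢0⇒n>0 (λ u≡0 → pj∤u (subst (p j ∣_) (sym u≡0) (p j ∣0)))
    qj⊥u : Coprime (q j) u
    qj⊥u = Coprimality.sym (coprime-^ (e j) (Coprimality.sym (prime∤⇒coprime (primes j) pj∤u)))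
    qj∣u[u∸1] : q j ∣ u * (u ∸ 1)
    qj∣u[u∸1] = subst (q j ∣_) (sym (*-distribˡ-∸ u u 1))
      (Remainders.%≡⇒∣∸ (q j) (u * u) (u * 1) (*-monoʳ-≤ u u≥1)
        (trans (%≡-down (q∣m j) idem) (cong (_% q j) (sym (*-identityʳ u)))))

  -- Tails among the elements of exact support I.  If g_I ∣ v, then v · v^K ≡ v for the
  -- idempotent power v^K, since v ≡ 0 mod q_j (j ∈ I) and v^K ≡ 1 mod q_j (j ∉ I).
  g∣⇒¬tail : ∀ {v} → ExactSupport v → gI ∣ v → ¬ Tail m v
  g∣⇒¬tail {v} support gI∣v tail with idempotent-power v
  ... | K , K≥1 , idem = tail K K≥1 (%≡⇒≡mod (crt v·v^K≡v))
    where
    v·v^K≡v : ∀ j → (v * v ^ K) % q j ≡ v % q j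
    v·v^K≡v j with lookup I j in j∈?I
    ... | true  = trans (Remainders.∣⇒%≡0 (q j) (∣m⇒∣m*n (v ^ K) qj∣v)) (sym (Remainders.∣⇒%≡0 (q j) qj∣v))
      where
      qj∣v : q j ∣ v
      qj∣v = ∣-trans (factor∣∏[] I q j j∈?I) gI∣v
    ... | false = trans (Remainders.%≡-*ˡ (q j) v (idempotent-p∤ idem j pj∤v^K))
                        (cong (λ x → _%_ x (q j) {{q≢0}}) (*-identityʳ v))
      where
      pj∤v^K : ¬ p j ∣ v ^ K
      pj∤v^K pj∣v^K with trans (sym (proj₁ (exactSupport-^ K K≥1 support j) pj∣v^K)) j∈?I
      ... | ()

  -- Conversely, v^{k+1} ≡ v with k ≥ 1 forces p_j^b ∣ v for all b ≤ e_j (by induction on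
  -- b, as p_j^{b+1} ∣ v · v^k), so q_j ∣ v for every j ∈ I, i.e. g_I ∣ v.
  ¬g∣⇒tail : ∀ {v} → ExactSupport v → ¬ gI ∣ v → Tail m v
  ¬g∣⇒tail {v} support gI∤v (suc k) _ v^2+k≡v = gI∤v (∏[]-∣ I e (λ j j∈I → pow∣v j j∈I (e j) ≤-refl))
    where
    pow∣v : ∀ j → lookup I j ≡ true → ∀ b → b ≤ e j → p j ^ b ∣ v
    pow∣v j j∈I zero    _        = 1∣ v
    pow∣v j j∈I (suc b) 1+b≤ej = Remainders.%≡-resp-∣ (p j ^ suc b) {{m^n≢0 (p j) (suc b)}}
      (%≡-down {{m^n≢0 (p j) (suc b)}} (∣-trans (^-∣-^ (p j) 1+b≤ej) (q∣m j)) (≡mod⇒%≡ v^2+k≡v))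
      (subst (_∣ v ^ suc (suc k)) (*-comm (p j ^ b) (p j))
        (*-pres-∣ (pow∣v j j∈I b (<⇒≤ 1+b≤ej)) (∣-trans (proj₂ (support j) j∈I) (∣^suc v k))))

  tail⇔ : ∀ {v} → ExactSupport v → Tail m v ⇔ (¬ gI ∣ v)
  tail⇔ support = mk⇔ (λ tail gI∣v → g∣⇒¬tail support gI∣v tail) (¬g∣⇒tail support)

  module Component (d : ℕ) (idem : IsIdem p e I d) where

    private
      d-residue : ∀ j → if lookup I j then d % q j ≡ 0 % q j else d % q j ≡ 1 % q j
      d-residue j with lookup I j | idem j
      ... | true  | d≡0 = Remainders.≡mod⇒%≡ (q j) d≡0
      ... | false | d≡1 = Remainders.≡mod⇒%≡ (q j) d≡1

    exactSupport-d : ExactSupport d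
    exactSupport-d j with lookup I j | d-residue j
    ... | true  | d≡0 = (λ _ → refl) , (λ _ → ∣-trans (p∣q j) (Remainders.%≡-resp-∣ (q j) (sym d≡0) (q j ∣0)))
    ... | false | d≡1 = (λ pj∣d → ⊥-elim (prime≢1 (primes j) (∣1⇒≡1 (pj∣1 pj∣d)))) , λ ()
      where
      pj∣1 : p j ∣ d → p j ∣ 1
      pj∣1 = Remainders.%≡-resp-∣ (p j) (%≡-down (p∣q j) d≡1)

    idempotent≡d : ∀ {u} → (u * u) % m ≡ u % m → ExactSupport u → u % m ≡ d % m
    idempotent≡d {u} idem-u support = crt u≡d
      where
      u≡d : ∀ j → u % q j ≡ d % q j
      u≡d j with lookup I j in j∈?I | d-residue j
      ... | true  | d≡0 = trans (idempotent-p∣ idem-u j (proj₂ (support j) j∈?I)) (sym d≡0)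
      ... | false | d≡1 = trans (idempotent-p∤ idem-u j pj∤u) (sym d≡1)
        where
        pj∤u : ¬ p j ∣ u
        pj∤u pj∣u with trans (sym (proj₁ (support j) pj∣u)) j∈?I
        ... | ()

    connected⇒exactSupport : ∀ {v} → SPConnected m v d → ExactSupport v
    connected⇒exactSupport path j =
      proj₁ (exactSupport-d j) ∘ Equivalence.to (p∣-connected path j) ,
      Equivalence.from (p∣-connected path j) ∘ proj₂ (exactSupport-d j)

    -- v is joined to its powers, and its idempotent power v^K (which is d) is joined to d
    -- by the edge (v^K, (v^K)²).
    exactSupport⇒connected : ∀ {v} → ExactSupport v → SPConnected m v d
    exactSupport⇒connected {v} support with idempotent-power v
    ... | suc k , K≥1 , idem-u = powers k ◅◅ (fwd (u , 1 , s≤s z≤n , u≡u^1 , d≡u^2) ◅ ε)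
      where
      u : ℕ
      u = v ^ suc k
      ≡mod-refl : ∀ x → x ≡ x [mod m ]
      ≡mod-refl x = %≡⇒≡mod {x} refl
      powers : ∀ n → SPConnected m v (v ^ suc n)
      powers zero    = subst (SPConnected m v) (sym (*-identityʳ v)) ε
      powers (suc n) = powers n ◅◅ (fwd (v , suc n , s≤s z≤n , ≡mod-refl (v ^ suc n) , ≡mod-refl (v ^ suc (suc n))) ◅ ε)
      u≡u^1 : u ≡ u ^ 1 [mod m ]
      u≡u^1 = %≡⇒≡mod (cong (_% m) (sym (*-identityʳ u)))
      d≡u^2 : d ≡ u ^ 2 [mod m ]
      d≡u^2 = %≡⇒≡mod (begin
        d % m           ≡⟨ idempotent≡d idem-u (exactSupport-^ (suc k) K≥1 support) ⟨
        u % m           ≡⟨ idem-u ⟨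
        (u * u) % m     ≡⟨ cong (λ x → (u * x) % m) (*-identityʳ u) ⟨
        (u * (u * 1)) % m ∎)
        where open ≡-Reasoning

    tail-of-component⇔ : ∀ v → (SPConnected m v d × Tail m v) ⇔ (InComponent v × ¬ gI ∣ v)
    tail-of-component⇔ v = mk⇔
      (λ (path , tail) → exactSupport⇒InComponent (connected⇒exactSupport path)
                       , Equivalence.to (tail⇔ (connected⇒exactSupport path)) tail)
      (λ (inComponent , gI∤v) → exactSupport⇒connected (InComponent⇒exactSupport inComponent)
                              , Equivalence.from (tail⇔ (InComponent⇒exactSupport inComponent)) gI∤v)

  -- Counting over 0 ≤ v < m.  The non-tails of the component are the v with g_I ∣ v and
  -- gcd(v, π_{∁I}) = 1 (g_I ∣ v implies π_I ∣ v); the tails are the rest of the component.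
  NonTail Tails : ℕ → Set
  NonTail v = gI ∣ v × gcd v π∁ ≡ 1
  Tails   v = InComponent v × ¬ gI ∣ v

  component? : ∀ v → Dec (InComponent v)
  component? v = (πI ∣? v) ×-dec (gcd v π∁ ≟ 1)

  nonTail? : ∀ v → Dec (NonTail v)
  nonTail? v = (gI ∣? v) ×-dec (gcd v π∁ ≟ 1)

  tails? : ∀ v → Dec (Tails v)
  tails? v = component? v ×-dec ¬? (gI ∣? v)

  count : ∀ {P : ℕ → Set} → (∀ v → Dec (P v)) → ℕ
  count P? = Σ< m (λ v → ifB (does (P? v)) 1)

  χcoprime : ℕ → ℕ
  χcoprime v = ifB (does (gcd v π∁ ≟ 1)) 1

  avoids-*⇔ : ∀ {c} → Avoids c → ∀ w → Avoids (w * c) ⇔ Avoids w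
  avoids-*⇔ {c} c-avoids w = mk⇔ (avoids-resp (λ _ _ → ∣m⇒∣m*n c)) (λ w-avoids → avoids-* w-avoids c-avoids)

  avoids-π∁+⇔ : ∀ w → Avoids (π∁ + w) ⇔ Avoids w
  avoids-π∁+⇔ w = mk⇔ (avoids-resp (λ j j∈∁ → ∣m∣n⇒∣m+n (factor∣∏[] (∁ I) p j j∈∁)))
                      (avoids-resp (λ j j∈∁ pj∣π∁+w → ∣m+n∣m⇒∣n pj∣π∁+w (factor∣∏[] (∁ I) p j j∈∁)))

  avoids-m∸⇔ : ∀ {v} → v ≤ m → Avoids (m ∸ v) ⇔ Avoids v
  avoids-m∸⇔ v≤m = mk⇔ (avoids-resp (λ j _ → Equivalence.from (∣∸⇔ (p∣m j) v≤m)))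
                       (avoids-resp (λ j _ → Equivalence.to (∣∸⇔ (p∣m j) v≤m)))

  coprime-π∁-transfer : ∀ {x y} → Avoids x ⇔ Avoids y → gcd x π∁ ≡ 1 ⇔ gcd y π∁ ≡ 1
  coprime-π∁-transfer {x} {y} x⇔y = ⇔.trans (coprime-π∁⇔ x) (⇔.trans x⇔y (⇔.sym (coprime-π∁⇔ y)))

  avoids-gI : Avoids gI
  avoids-gI = avoids-∏[I] e

  avoids-πI : Avoids πI
  avoids-πI = subst Avoids (sym (∏[]-^1 I p)) (avoids-∏[I] (λ _ → 1))

  -- The non-tails are g_I·w with gcd(w, g_{∁I}) = 1, w < g_{∁I}: there are φ(g_{∁I}) of them.
  count-nonTail : count nonTail? ≡ φ g∁
  count-nonTail = begin
    count nonTail?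
      ≡⟨ Σ<-cong m (λ v _ → ifB-×-dec (gI ∣? v) (gcd v π∁ ≟ 1)) ⟩
    Σ< m (λ v → if does (gI ∣? v) then χcoprime v else 0)
      ≡⟨ cong (λ n → Σ< n (λ v → if does (gI ∣? v) then χcoprime v else 0)) m≡g∁*gI ⟩
    Σ< (g∁ * gI) (λ v → if does (gI ∣? v) then χcoprime v else 0)
      ≡⟨ Σ<-multiples g∁ gI χcoprime ⟩
    Σ< g∁ (λ w → χcoprime (w * gI))
      ≡⟨ Σ<-cong g∁ (λ w _ → cong (λ b → ifB b 1) (does-⇔ (coprime⇔ w) (gcd (w * gI) π∁ ≟ 1) (gcd w g∁ ≟ 1))) ⟩
    Σ< g∁ (λ w → ifB (does (gcd w g∁ ≟ 1)) 1)
      ≡⟨ length-filter (λ k → gcd k g∁ ≟ 1) id g∁ ⟨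
    φ g∁ ∎
    where
    open ≡-Reasoning
    m≡g∁*gI : m ≡ g∁ * gI
    m≡g∁*gI = trans m≡gI*g∁ (*-comm gI g∁)
    coprime⇔ : ∀ w → gcd (w * gI) π∁ ≡ 1 ⇔ gcd w g∁ ≡ 1
    coprime⇔ w = ⇔.trans (coprime-π∁⇔ (w * gI)) (⇔.trans (avoids-*⇔ avoids-gI w) (⇔.sym (coprime-g∁⇔ w)))

  -- The component consists of the π_I·w with gcd(w, π_{∁I}) = 1, w < m/π_I; this condition
  -- has period π_{∁I}, so the component has (m/π_R)·φ(π_{∁I}) elements.
  count-component : πR * count component? ≡ m * φ π∁
  count-component = begin
    πR * count component?  ≡⟨ cong (πR *_) count≡ ⟩
    πR * (K * φ π∁)        ≡⟨ *-assoc πR K (φ π∁) ⟨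
    πR * K * φ π∁          ≡⟨ cong (_* φ π∁) (trans (*-comm πR K) (sym m≡K*πR)) ⟩
    m * φ π∁               ∎
    where
    open ≡-Reasoning
    K : ℕ
    K = quotient πR∣m
    m≡K*πR : m ≡ K * πR
    m≡K*πR = m∣n⇒n≡quotient*m πR∣m
    m≡K*π∁*πI : m ≡ K * π∁ * πI
    m≡K*π∁*πI = begin
      m              ≡⟨ m≡K*πR ⟩
      K * πR         ≡⟨ cong (K *_) (trans πR≡πI*π∁ (*-comm πI π∁)) ⟩
      K * (π∁ * πI)  ≡⟨ *-assoc K π∁ πI ⟨
      K * π∁ * πI    ∎
    count≡ : count component? ≡ K * φ π∁
    count≡ = begin
      count component?
        ≡⟨ Σ<-cong m (λ v _ → ifB-×-dec (πI ∣? v) (gcd v π∁ ≟ 1)) ⟩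
      Σ< m (λ v → if does (πI ∣? v) then χcoprime v else 0)
        ≡⟨ cong (λ n → Σ< n (λ v → if does (πI ∣? v) then χcoprime v else 0)) m≡K*π∁*πI ⟩
      Σ< (K * π∁ * πI) (λ v → if does (πI ∣? v) then χcoprime v else 0)
        ≡⟨ Σ<-multiples (K * π∁) πI χcoprime ⟩
      Σ< (K * π∁) (λ w → χcoprime (w * πI))
        ≡⟨ Σ<-cong (K * π∁) (λ w _ → cong (λ b → ifB b 1)
             (does-⇔ (coprime-π∁-transfer (avoids-*⇔ avoids-πI w)) (gcd (w * πI) π∁ ≟ 1) (gcd w π∁ ≟ 1))) ⟩
      Σ< (K * π∁) χcoprime
        ≡⟨ Σ<-periodic K π∁ χcoprime (λ w → cong (λ b → ifB b 1)
             (does-⇔ (coprime-π∁-transfer (avoids-π∁+⇔ w)) (gcd (π∁ + w) π∁ ≟ 1) (gcd w π∁ ≟ 1))) ⟩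
      K * Σ< π∁ χcoprime
        ≡⟨ cong (K *_) (length-filter (λ k → gcd k π∁ ≟ 1) id π∁) ⟨
      K * φ π∁ ∎

  count-component≡ : count component? ≡ count tails? + count nonTail?
  count-component≡ = trans (Σ<-cong m (λ v _ → ifB-partition (πI ∣? v) (gcd v π∁ ≟ 1) (gI ∣? v) (∣-trans πI∣gI)))
                           (Σ<-+ m _ _)

  -- v ↦ m − v maps tails to tails, so they average to m/2.
  sum-tails : 2 * Σ< m (λ v → ifB (does (tails? v)) v) ≡ m * count tails?
  sum-tails = Σ<-symmetric m (λ v → does (tails? v)) (dec-false (tails? 0) (λ (_ , gI∤0) → gI∤0 (gI ∣0)))
    (λ v _ v<m → does-⇔ (tails⇔ (<⇒≤ v<m)) (tails? v) (tails? (m ∸ v)))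
    where
    tails⇔ : ∀ {v} → v ≤ m → Tails v ⇔ Tails (m ∸ v)
    tails⇔ v≤m = mk⇔
      (λ ((πI∣v , coprime) , gI∤v) → (Equivalence.from (∣∸⇔ πI∣m v≤m) πI∣v
                                      , Equivalence.from (coprime-π∁-transfer (avoids-m∸⇔ v≤m)) coprime)
                                    , gI∤v ∘ Equivalence.to (∣∸⇔ gI∣m v≤m))
      (λ ((πI∣m∸v , coprime) , gI∤m∸v) → (Equivalence.to (∣∸⇔ πI∣m v≤m) πI∣m∸v
                                      , Equivalence.to (coprime-π∁-transfer (avoids-m∸⇔ v≤m)) coprime)
                                    , gI∤m∸v ∘ Equivalence.from (∣∸⇔ gI∣m v≤m))

  tail-sum-identity : 2 * πR * Σ< m (λ v → ifB (does (tails? v)) v) + m * πR * φ g∁ ≡ m * m * φ π∁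
  tail-sum-identity = begin
    2 * πR * s + m * πR * φ g∁                         ≡⟨ cong₂ (λ x y → x + m * πR * y) (rearrange₁ πR s) count-nonTail ⟨
    πR * (2 * s) + m * πR * count nonTail?             ≡⟨ cong (λ x → πR * x + m * πR * count nonTail?) sum-tails ⟩
    πR * (m * count tails?) + m * πR * count nonTail?  ≡⟨ rearrange₂ πR m (count tails?) (count nonTail?) ⟩
    m * (πR * (count tails? + count nonTail?))         ≡⟨ cong (λ x → m * (πR * x)) count-component≡ ⟨
    m * (πR * count component?)                        ≡⟨ cong (m *_) count-component ⟩
    m * (m * φ π∁)                                     ≡⟨ *-assoc m m (φ π∁) ⟨
    m * m * φ π∁                                       ∎
    where
    open ≡-Reasoning
    open +-*-Solver
    s : ℕ
    s = Σ< m (λ v → ifB (does (tails? v)) v)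
    rearrange₁ : ∀ a b → a * (2 * b) ≡ 2 * a * b
    rearrange₁ = solve 2 (λ a b → a :* (con 2 :* b) := con 2 :* a :* b) refl
    rearrange₂ : ∀ a b x y → a * (b * x) + b * a * y ≡ b * (a * (x + y))
    rearrange₂ = solve 4 (λ a b x y → a :* (b :* x) :+ b :* a :* y := b :* (a :* (x :+ y))) refl

open import Data.Integer using (+_; _-_)

mainTheorem20 : (r : ℕ) (p e : Fin r → ℕ) →
    (∀ i → Prime (p i)) → Injective _≡_ _≡_ p → (∀ i → 1 ≤ e i) →
    (I : Subset r) (d : ℕ) → d < modulus p e → IsIdem p e I d →
    (L : List ℕ) → Unique L →
    (∀ v → (v ∈ L) ⇔ ((v < modulus p e) × SPConnected (modulus p e) v d × Tail (modulus p e) v)) →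
    + (2 * πS p ⊤ * sum L) ≡
      + (modulus p e * modulus p e * φ (πS p (∁ I))) - + (modulus p e * πS p ⊤ * φ (gS p e (∁ I)))
mainTheorem20 r p e primes p-inj e≥1 I d _ idem L unique L⇔ = begin
  + (2 * πR * sum L)                                ≡⟨ cong (λ x → + (2 * πR * x)) (sum-enumeration tails? m L unique L⇔tails) ⟩
  + (2 * πR * Σ< m (λ v → ifB (does (tails? v)) v)) ≡⟨ +-as-difference tail-sum-identity ⟩
  + (m * m * φ π∁) - + (m * πR * φ g∁)              ∎
  where
  open ≡-Reasoning
  open Setting r p e primes p-inj e≥1 I
  open Component d idem
  L⇔tails : ∀ v → v ∈ L ⇔ (v < m × Tails v)
  L⇔tails v = ⇔.trans (L⇔ v) (mk⇔ (λ (v<m , tail) → v<m , Equivalence.to (tail-of-component⇔ v) tail)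
                                  (λ (v<m , tail) → v<m , Equivalence.from (tail-of-component⇔ v) tail))
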